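{- Suppose the jobs are indexed so that $d_1\le d_2\le\dots\le d_n$. Let $S\subseteq J$ be a set of scheduled jobs and let $\sigma$ be a proper schedule of $S$ in which every job of $S$ completes by its due date. Let $\sigma'$ be the intermediate schedule obtained from $\sigma$ by an admissible swap (at some step $j^*\in S$ between machines $M_h$ and $M_i$). Then $\sum w_jU_j(\sigma')\le\sum w_jU_j(\sigma)$.
   Context: Setting: $m$ identical parallel machines $M_1,\dots,M_m$ and jobs $J=\{1,\dots,n\}$; job $j$ has positive integer processing time $p_j$, nonnegative integer weight $w_j$ and integer due date $d_j$. Let $p_{\max}=\max_{j\in J} p_j$; for $X\subseteq J$ let $P(X)=\sum_{j\in X}p_j$. In the problem $Pm||\sum w_jU_j$ we use the formulation in which a solution consists of a set $S\subseteq J$ of scheduled jobs together with a schedule of $S$; jobs not in $S$ are discarded. For a schedule $\tau$ of $S$ (each machine processes its assigned jobs of $S$ in a given sequence without idle time from time $0$; $C_j$ is the time job $j$ finishes), $\sum w_jU_j(\tau):=\sum_{j\in J\setminus S}w_j+\sum_{j\in S,\,C_j>d_j}w_j$. Let $S_j=S\cap\{1,\dots,j\}$. A proper schedule $\sigma$ of $S$ is a partition $S=S_1(\sigma)\cup\dots\cup S_m(\sigma)$ ($S_i(\sigma)$ = jobs on $M_i$), each machine processing its jobs in increasing order of index without idle time from time $0$; let $S_{i,j}(\sigma)=S_i(\sigma)\cap S_j$. The swap (for proper schedules of $S$): let $j^*\in S$ and $h,i\in\{1,\dots,m\}$. The swap is admissible for $\sigma$ at step $j^*$ (with machines $M_h,M_i$)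 if (i) $j^*\in S_{h}(\sigma)$; (ii) $|S_i(\sigma)\setminus S_{i,j^*}(\sigma)|\ge 2p_{\max}$; (iii) $P(S_{h,j^*}(\sigma))-P(S_{i,j^*}(\sigma))\ge 4p_{\max}^2$. In that case let $J_I$ be the first $2p_{\max}$ jobs (in processing order on $M_i$) of $S_i(\sigma)\setminus S_{i,j^*}(\sigma)$ and $J_H$ the last $2p_{\max}$ jobs (in processing order on $M_h$) of $S_{h,j^*}(\sigma)$. Choose nonempty $J_{H'}\subseteq J_H$ and $J_{I'}\subseteq J_I$ with $P(J_{H'})=P(J_{I'})$, and let $J_{H''}=J_H\setminus J_{H'}$, $J_{I''}=J_I\setminus J_{I'}$. The intermediate schedule $\sigma'$ (of the same set $S$) changes only $M_h$ and $M_i$: on $M_h$ the consecutive block $J_H$ is replaced by the jobs of $J_{H''}$ (in their order in $\sigma$) followed by the jobs of $J_{I'}$ (in their order in $\sigma$); on $M_i$ the consecutive block $J_I$ is replaced by the jobs of $J_{H'}$ (in their order in $\sigma$) followed by the jobs of $J_{I''}$ (in their order in $\sigma$); all other jobs keep their machine and relative order, and machines process jobs without idle time. -}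

module Defs where

open import Data.Nat using (ℕ; zero; suc; _+_; _*_; _∸_; _^_; _≤_; _⊔_; _≤ᵇ_; _<ᵇ_)
open import Data.Fin using (Fin; toℕ)
open import Data.Fin.Properties using () renaming (_≟_ to _≟ᶠ_)
open import Data.Bool using (Bool; true; false; if_then_else_; not)
open import Data.List using (List; []; _∷_; _++_; map; foldr; filterᵇ; take; drop; length; allFin)
open import Data.Nat.ListAction using (sum)
open import Data.Integer as ℤ using (ℤ; +_)
open import Data.Integer.Properties using () renaming (_<?_ to _<ℤ?_)
open import Relation.Nullary.Decidable using (⌊_⌋)
open import Relation.Binary.PropositionalEquality using (_≡_)

-- Jobs are the elements of Fin n; job index order is the order of toℕ.
-- p, w : Fin n → ℕ (processing times, weights); d : Fin n → ℤ (due dates).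

pmax : {n : ℕ} → (Fin n → ℕ) → ℕ
pmax {n} p = foldr _⊔_ 0 (map p (allFin n))

P : {n : ℕ} → (Fin n → ℕ) → List (Fin n) → ℕ
P p xs = sum (map p xs)

-- A (general) schedule of m machines: each machine gets a sequence of jobs,
-- processed in that order without idle time from time 0.
Schedule : ℕ → ℕ → Set
Schedule n m = Fin m → List (Fin n)

lateWeight : {n : ℕ} → (Fin n → ℕ) → (Fin n → ℕ) → (Fin n → ℤ) → ℕ → List (Fin n) → ℕ
lateWeight p w d t [] = 0
lateWeight p w d t (j ∷ js) =
  (if ⌊ d j <ℤ? + (t + p j) ⌋ then w j else 0) + lateWeight p w d (t + p j) js

-- Σ w_j U_j(τ) for a schedule τ of the scheduled set S (S given as a Boolean
-- predicate): discarded jobs plus late scheduled jobs.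
sumWU : {n m : ℕ} → (Fin n → ℕ) → (Fin n → ℕ) → (Fin n → ℤ) →
        (Fin n → Bool) → Schedule n m → ℕ
sumWU {n} {m} p w d S τ =
  sum (map (λ j → if S j then 0 else w j) (allFin n))
  + sum (map (λ k → lateWeight p w d 0 (τ k)) (allFin m))

-- A proper schedule σ of S is given by a machine assignment
-- mach : Fin n → Fin m (only its values on S matter): S_i(σ) = {j ∈ S | mach j = i}.
-- Jobs of S_i(σ) in increasing index order:
machineJobs : {n m : ℕ} → (Fin n → Bool) → (Fin n → Fin m) → Fin m → List (Fin n)
machineJobs {n} S mach i =
  filterᵇ (λ j → if S j then ⌊ mach j ≟ᶠ i ⌋ else false) (allFin n)

properSchedule : {n m : ℕ} → (Fin n → Bool) → (Fin n → Fin m) → Schedule n m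
properSchedule S mach = machineJobs S mach

upTo : {n m : ℕ} → (Fin n → Bool) → (Fin n → Fin m) → Fin m → Fin n → List (Fin n)
upTo S mach i j = filterᵇ (λ k → toℕ k ≤ᵇ toℕ j) (machineJobs S mach i)

after : {n m : ℕ} → (Fin n → Bool) → (Fin n → Fin m) → Fin m → Fin n → List (Fin n)
after S mach i j = filterᵇ (λ k → toℕ j <ᵇ toℕ k) (machineJobs S mach i)

completion : {n m : ℕ} → (Fin n → ℕ) → (Fin n → Bool) → (Fin n → Fin m) → Fin n → ℕ
completion p S mach j = P p (upTo S mach (mach j) j)

record Admissible {n m : ℕ} (p : Fin n → ℕ) (S : Fin n → Bool) (mach : Fin n → Fin m)
                  (jstar : Fin n) (h i : Fin m) : Set where
  field
    jstar∈S  : S jstar ≡ true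
    jstar∈Mh : mach jstar ≡ h
    condII   : 2 * pmax p ≤ length (after S mach i jstar)
    condIII  : P p (upTo S mach i jstar) + 4 * pmax p ^ 2 ≤ P p (upTo S mach h jstar)

JH : {n m : ℕ} → (Fin n → ℕ) → (Fin n → Bool) → (Fin n → Fin m) → Fin n → Fin m → List (Fin n)
JH p S mach jstar h =
  drop (length (upTo S mach h jstar) ∸ 2 * pmax p) (upTo S mach h jstar)

JI : {n m : ℕ} → (Fin n → ℕ) → (Fin n → Bool) → (Fin n → Fin m) → Fin n → Fin m → List (Fin n)
JI p S mach jstar i = take (2 * pmax p) (after S mach i jstar)

-- The intermediate schedule σ'. Subsets J_H' ⊆ J_H and J_I' ⊆ J_I are given by
-- Boolean masks H', I' : J_H' = filter H' J_H, J_H'' = J_H \ J_H', etc.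
intermediate : {n m : ℕ} → (Fin n → ℕ) → (Fin n → Bool) → (Fin n → Fin m) →
               Fin n → Fin m → Fin m → (Fin n → Bool) → (Fin n → Bool) → Schedule n m
intermediate p S mach jstar h i H' I' k =
  if ⌊ k ≟ᶠ h ⌋
    then A ++ filterᵇ (λ j → not (H' j)) jH ++ filterᵇ I' jI ++ after S mach h jstar
    else (if ⌊ k ≟ᶠ i ⌋
      then upTo S mach i jstar ++ filterᵇ H' jH ++ filterᵇ (λ j → not (I' j)) jI
             ++ drop (2 * pmax p) (after S mach i jstar)
      else machineJobs S mach k)
  where
    preH = upTo S mach h jstar
    A    = take (length preH ∸ 2 * pmax p) preH
    jH   = JH p S mach jstar h
    jI   = JI p S mach jstar i

{-# OPTIONS --safe #-}
module Submission where

-- σ meets every due date, so it is enough that σ′ does too: then σ′ pays only for the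
-- discarded jobs, the least any schedule of S can pay.  Only M_h and M_i change, and on each
-- of them the jobs after the exchanged block start exactly when they did in σ, because
-- P(J_H′) = P(J_I′).  On M_h the jobs of J_H″ only move earlier, and J_I′ ends at
-- C_{j*} = P(S_{h,j*}) ≤ d_{j*}, which is at most the due date of every job of J_I since
-- their indices exceed j*.  On M_i, blocks of 2p_max jobs take at most 2p_max² time, so by
-- (iii) J_H′ ends by the time J_H started on M_h, hence by its own due dates, and J_I″ ends
-- by P(S_{h,j*}).

open import Defs
open import Data.Nat using (ℕ; _≤_; _<_)
open import Data.Fin using (Fin; toℕ)
open import Data.Bool using (Bool; true; not)
open import Data.List using (List; []; filterᵇ)
open import Data.Integer as ℤ using (ℤ; +_)
open import Relation.Binary.PropositionalEquality using (_≡_; _≢_)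

open import Data.Nat using (z≤n; _+_; _*_; _∸_; _^_; _⊔_; _≤ᵇ_; _<ᵇ_; _≤?_)
open import Data.Nat.Properties
open import Algebra.Properties.CommutativeSemigroup +-commutativeSemigroup using (x∙yz≈y∙xz)
open import Data.Nat.ListAction using (sum)
open import Data.Nat.ListAction.Properties using (sum-++)
open import Data.Nat.Solver using (module +-*-Solver)
import Data.Fin as Fin
open import Data.Fin.Properties using () renaming (_≟_ to _≟ᶠ_)
open import Data.Bool using (false; if_then_else_; T)
open import Data.List using (_∷_; _++_; map; foldr; take; drop; length; allFin)
open import Data.List.Properties
  using (map-++; ++-assoc; take++drop≡id; length-take; length-drop;
         filter-accept; filter-reject; filter-all; filter-none)
open import Data.List.Membership.Propositional using (_∈_)
open import Data.List.Membership.Propositional.Properties using (∈-allFin; ∈-map⁺)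
open import Data.List.Relation.Unary.Any using (here; there)
open import Data.List.Relation.Unary.All as All using (All; []; _∷_)
open import Data.List.Relation.Unary.All.Properties using (all-filter; take⁺)
  renaming (filter⁺ to All-filter⁺)
open import Data.List.Relation.Unary.AllPairs using (AllPairs; []; _∷_)
open import Data.List.Relation.Unary.AllPairs.Properties using (tabulate⁺-<)
  renaming (filter⁺ to AllPairs-filter⁺)
open import Data.Integer.Properties as ℤP using () renaming (_<?_ to _<ℤ?_)
open import Data.Product using (_×_; _,_)
open import Data.Empty using (⊥-elim)
open import Function using (_∘_; id)
open import Relation.Nullary using (Dec; yes; no; ¬_)
open import Relation.Nullary.Decidable using (⌊_⌋; T?)
open import Relation.Binary.PropositionalEquality
  using (refl; sym; trans; cong; cong₂; subst; subst₂; module ≡-Reasoning)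

Increasing : ∀ {n} → List (Fin n) → Set
Increasing = AllPairs Fin._<_

allFin-increasing : ∀ n → Increasing (allFin n)
allFin-increasing n = tabulate⁺-< id

module _ {n : ℕ} (j : Fin n) where
  private
    ≤j >j : Fin n → Bool
    ≤j k = toℕ k ≤ᵇ toℕ j
    >j k = toℕ j <ᵇ toℕ k

  filter-≤-++-filter-> : ∀ {xs} → Increasing xs →
                         filterᵇ ≤j xs ++ filterᵇ >j xs ≡ xs
  filter-≤-++-filter-> [] = refl
  filter-≤-++-filter-> {x ∷ xs} (x<xs ∷ inc) with toℕ x ≤? toℕ j
  ... | yes x≤j = trans
    (cong₂ _++_ (filter-accept (T? ∘ ≤j) {x} {xs} (≤⇒≤ᵇ x≤j))
                (filter-reject (T? ∘ >j) {x} {xs} (≤⇒≯ x≤j ∘ <ᵇ⇒< _ _)))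
    (cong (x ∷_) (filter-≤-++-filter-> inc))
  ... | no x≰j = cong₂ _++_
    (trans (filter-reject (T? ∘ ≤j) {x} {xs} (x≰j ∘ ≤ᵇ⇒≤ _ _))
           (filter-none (T? ∘ ≤j) {xs} (All.map (λ x<y → j≮y (<-trans j<x x<y)) x<xs)))
    (trans (filter-accept (T? ∘ >j) {x} {xs} (<⇒<ᵇ j<x))
           (cong (x ∷_) (filter-all (T? ∘ >j) {xs} (All.map (<⇒<ᵇ ∘ <-trans j<x) x<xs))))
    where
    j<x : toℕ j < toℕ x
    j<x = ≰⇒> x≰j
    j≮y : ∀ {y} → toℕ j < toℕ y → ¬ T (≤j y)
    j≮y j<y = <⇒≱ j<y ∘ ≤ᵇ⇒≤ _ _

module _ {n : ℕ} (p : Fin n → ℕ) where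

  P-++ : ∀ xs ys → P p (xs ++ ys) ≡ P p xs + P p ys
  P-++ xs ys = trans (cong sum (map-++ p xs ys)) (sum-++ (map p xs) (map p ys))

  P-filter-+-P-filter-not : ∀ f xs →
                            P p (filterᵇ f xs) + P p (filterᵇ (not ∘ f) xs) ≡ P p xs
  P-filter-+-P-filter-not f [] = refl
  P-filter-+-P-filter-not f (x ∷ xs) with f x
  ... | true = trans (+-assoc (p x) _ _) (cong (_+_ (p x)) (P-filter-+-P-filter-not f xs))
  ... | false = trans (x∙yz≈y∙xz (P p (filterᵇ f xs)) (p x) _)
                      (cong (_+_ (p x)) (P-filter-+-P-filter-not f xs))

  P-filter-≤ : ∀ f xs → P p (filterᵇ f xs) ≤ P p xs
  P-filter-≤ f xs = ≤-trans (m≤m+n _ _) (≤-reflexive (P-filter-+-P-filter-not f xs))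

  p≤pmax : ∀ j → p j ≤ pmax p
  p≤pmax j = ∈⇒≤foldr-⊔ (map p (allFin n)) (∈-map⁺ p (∈-allFin j))
    where
    ∈⇒≤foldr-⊔ : ∀ {a} as → a ∈ as → a ≤ foldr _⊔_ 0 as
    ∈⇒≤foldr-⊔ (b ∷ bs) (here refl)  = m≤m⊔n b _
    ∈⇒≤foldr-⊔ (b ∷ bs) (there a∈bs) =
      ≤-trans (∈⇒≤foldr-⊔ bs a∈bs) (m≤n⊔m b _)

  P≤length*pmax : ∀ xs → P p xs ≤ length xs * pmax p
  P≤length*pmax [] = z≤n
  P≤length*pmax (x ∷ xs) = +-mono-≤ (p≤pmax x) (P≤length*pmax xs)

  P≤*pmax : ∀ {k} xs → length xs ≤ k → P p xs ≤ k * pmax p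
  P≤*pmax xs length≤k = ≤-trans (P≤length*pmax xs) (*-monoˡ-≤ (pmax p) length≤k)

module _ {n : ℕ} (p : Fin n → ℕ) (d : Fin n → ℤ) where

  data OnTime : ℕ → List (Fin n) → Set where
    []  : ∀ {t} → OnTime t []
    _∷_ : ∀ {t j js} → + (t + p j) ℤ.≤ d j → OnTime (t + p j) js → OnTime t (j ∷ js)

  onTime-earlier : ∀ {s t xs} → s ≤ t → OnTime t xs → OnTime s xs
  onTime-earlier s≤t [] = []
  onTime-earlier s≤t (ok ∷ rest) =
    ℤP.≤-trans (ℤ.+≤+ (+-monoˡ-≤ _ s≤t)) ok
    ∷ onTime-earlier (+-monoˡ-≤ _ s≤t) rest

  onTime-++⁻ˡ : ∀ {t} xs {ys} → OnTime t (xs ++ ys) → OnTime t xs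
  onTime-++⁻ˡ [] _ = []
  onTime-++⁻ˡ (x ∷ xs) (ok ∷ rest) = ok ∷ onTime-++⁻ˡ xs rest

  onTime-++⁻ʳ : ∀ {t} xs {ys} → OnTime t (xs ++ ys) → OnTime (t + P p xs) ys
  onTime-++⁻ʳ {t} [] {ys} rest = subst (λ s → OnTime s ys) (sym (+-identityʳ t)) rest
  onTime-++⁻ʳ {t} (x ∷ xs) {ys} (_ ∷ rest) =
    subst (λ s → OnTime s ys) (+-assoc t (p x) (P p xs)) (onTime-++⁻ʳ xs rest)

  onTime-++⁺ : ∀ {t xs ys} → OnTime t xs → OnTime (t + P p xs) ys → OnTime t (xs ++ ys)
  onTime-++⁺ {t} {ys = ys} [] rest = subst (λ s → OnTime s ys) (+-identityʳ t) rest
  onTime-++⁺ {t} {x ∷ xs} {ys} (ok ∷ oks) rest =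
    ok ∷ onTime-++⁺ oks (subst (λ s → OnTime s ys) (sym (+-assoc t (p x) (P p xs))) rest)

  onTime-filter⁺ : ∀ f {t xs} → OnTime t xs → OnTime t (filterᵇ f xs)
  onTime-filter⁺ f [] = []
  onTime-filter⁺ f {xs = x ∷ xs} (ok ∷ rest) with f x
  ... | true  = ok ∷ onTime-filter⁺ f rest
  ... | false = onTime-earlier (m≤m+n _ _) (onTime-filter⁺ f rest)

  onTime-by : ∀ T {t xs} → t + P p xs ≤ T → All (λ j → + T ℤ.≤ d j) xs →
              OnTime t xs
  onTime-by T _ [] = []
  onTime-by T {t} {x ∷ xs} done (T≤dx ∷ T≤ds) =
    ℤP.≤-trans (ℤ.+≤+ (≤-trans (+-monoʳ-≤ t (m≤m+n (p x) (P p xs))) done)) T≤dx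
    ∷ onTime-by T (≤-trans (≤-reflexive (+-assoc t (p x) (P p xs))) done) T≤ds

  onTime⇒start≤due : ∀ {t xs} → OnTime t xs → All (λ j → + t ℤ.≤ d j) xs
  onTime⇒start≤due [] = []
  onTime⇒start≤due {t} (ok ∷ rest) =
    ℤP.≤-trans t≤t+p ok ∷ All.map (ℤP.≤-trans t≤t+p) (onTime⇒start≤due rest)
    where
    t≤t+p : + t ℤ.≤ + (t + _)
    t≤t+p = ℤ.+≤+ (m≤m+n t _)

  onTime-exchange : ∀ {t} xs {ys zs} ys₁ ys₂ → OnTime t (xs ++ ys ++ zs) →
    OnTime (t + P p xs) (ys₁ ++ ys₂) → P p ys₁ + P p ys₂ ≡ P p ys →
    OnTime t (xs ++ ys₁ ++ ys₂ ++ zs)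
  onTime-exchange {t} xs {ys} {zs} ys₁ ys₂ old new same-duration =
    onTime-++⁺ (onTime-++⁻ˡ xs old)
      (subst (OnTime _) (++-assoc ys₁ ys₂ zs) (onTime-++⁺ new (subst (λ s → OnTime s zs)
        (cong (_+_ (t + P p xs)) (sym (trans (P-++ p ys₁ ys₂) same-duration)))
        (onTime-++⁻ʳ ys (onTime-++⁻ʳ xs old)))))

  lateWeight-onTime : ∀ w {t xs} → OnTime t xs → lateWeight p w d t xs ≡ 0
  lateWeight-onTime w [] = refl
  lateWeight-onTime w {t} {x ∷ xs} (ok ∷ rest) with d x <ℤ? + (t + p x)
  ... | yes late = ⊥-elim (ℤP.≤⇒≯ ok late)
  ... | no _     = lateWeight-onTime w rest

  onTime-if-prefixes-due : ∀ {t xs} → Increasing xs →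
    All (λ j → + (t + P p (filterᵇ (λ k → toℕ k ≤ᵇ toℕ j) xs)) ℤ.≤ d j) xs →
    OnTime t xs
  onTime-if-prefixes-due [] [] = []
  onTime-if-prefixes-due {t} {x ∷ xs} (x<xs ∷ inc) (x-due ∷ xs-due) =
    subst (λ s → + (t + s) ℤ.≤ d x) prefix-x x-due
    ∷ onTime-if-prefixes-due inc (All.zipWith shift (x<xs , xs-due))
    where
    ≤_ : Fin n → Fin n → Bool
    (≤ j) k = toℕ k ≤ᵇ toℕ j
    prefix-x : P p (filterᵇ (≤ x) (x ∷ xs)) ≡ p x
    prefix-x = begin
      P p (filterᵇ (≤ x) (x ∷ xs))
        ≡⟨ cong (P p) (filter-accept (T? ∘ ≤ x) {x} {xs} (≤⇒≤ᵇ (≤-refl {toℕ x}))) ⟩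
      p x + P p (filterᵇ (≤ x) xs)
        ≡⟨ cong (_+_ (p x) ∘ P p) (filter-none (T? ∘ ≤ x) {xs} (All.map x≮y x<xs)) ⟩
      p x + 0
        ≡⟨ +-identityʳ (p x) ⟩
      p x ∎
      where
      open ≡-Reasoning
      x≮y : ∀ {y} → toℕ x < toℕ y → ¬ T ((≤ x) y)
      x≮y x<y = <⇒≱ x<y ∘ ≤ᵇ⇒≤ _ _
    shift : ∀ {y} → Fin._<_ x y × + (t + P p (filterᵇ (≤ y) (x ∷ xs))) ℤ.≤ d y →
            + (t + p x + P p (filterᵇ (≤ y) xs)) ℤ.≤ d y
    shift {y} (x<y , y-due) = subst (λ s → + s ℤ.≤ d y)
      (trans (cong (λ zs → t + P p zs)
                   (filter-accept (T? ∘ ≤ y) {x} {xs} (≤⇒≤ᵇ (<⇒≤ x<y))))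
             (sym (+-assoc t (p x) _)))
      y-due

module _ {n m : ℕ} (S : Fin n → Bool) (mach : Fin n → Fin m) where

  machineJobs-increasing : ∀ k → Increasing (machineJobs S mach k)
  machineJobs-increasing k = AllPairs-filter⁺ _ (allFin-increasing n)

  machineJobs-assigned : ∀ k →
    All (λ j → S j ≡ true × mach j ≡ k) (machineJobs S mach k)
  machineJobs-assigned k =
    All.map (λ {j} → assigned (S j) (mach j ≟ᶠ k)) (all-filter _ (allFin n))
    where
    assigned : ∀ {j} (s : Bool) (e : Dec (j ≡ k)) →
               T (if s then ⌊ e ⌋ else false) → s ≡ true × j ≡ k
    assigned true (yes j≡k) _ = refl , j≡k

  upTo-++-after : ∀ k j → upTo S mach k j ++ after S mach k j ≡ machineJobs S mach k
  upTo-++-after k j = filter-≤-++-filter-> j (machineJobs-increasing k)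

  machineJobs-onTime : (p : Fin n → ℕ) (d : Fin n → ℤ) →
    (∀ j → S j ≡ true → + completion p S mach j ℤ.≤ d j) →
    ∀ k → OnTime p d 0 (machineJobs S mach k)
  machineJobs-onTime p d all-due k =
    onTime-if-prefixes-due p d (machineJobs-increasing k)
      (All.map (λ { (j∈S , refl) → all-due _ j∈S }) (machineJobs-assigned k))

onTime⇒sumWU-minimal : ∀ {n m} (p w : Fin n → ℕ) (d : Fin n → ℤ) (S : Fin n → Bool)
  (τ τ′ : Schedule n m) → (∀ k → OnTime p d 0 (τ k)) →
  sumWU p w d S τ ≤ sumWU p w d S τ′
onTime⇒sumWU-minimal {n} {m} p w d S τ τ′ τ-onTime = begin
  discarded + sum (map (λ k → lateWeight p w d 0 (τ k)) (allFin m))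
    ≡⟨ cong (_+_ discarded) (sum-map-0 (allFin m) (lateWeight-onTime p d w ∘ τ-onTime)) ⟩
  discarded + 0
    ≡⟨ +-identityʳ discarded ⟩
  discarded
    ≤⟨ m≤m+n discarded _ ⟩
  sumWU p w d S τ′ ∎
  where
  open ≤-Reasoning
  discarded : ℕ
  discarded = sum (map (λ j → if S j then 0 else w j) (allFin n))
  sum-map-0 : ∀ {f : Fin m → ℕ} ks → (∀ k → f k ≡ 0) → sum (map f ks) ≡ 0
  sum-map-0 [] _ = refl
  sum-map-0 (k ∷ ks) f≡0 = cong₂ _+_ (f≡0 k) (sum-map-0 ks f≡0)

module Swap {n m : ℕ} (p : Fin n → ℕ) (d : Fin n → ℤ)
  (d-mono : ∀ j k → toℕ j ≤ toℕ k → d j ℤ.≤ d k)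
  (S : Fin n → Bool) (mach : Fin n → Fin m)
  (σ-due : ∀ j → S j ≡ true → + completion p S mach j ℤ.≤ d j)
  {jstar : Fin n} {h i : Fin m} (adm : Admissible p S mach jstar h i)
  (H' I' : Fin n → Bool)
  (balanced : P p (filterᵇ H' (JH p S mach jstar h)) ≡ P p (filterᵇ I' (JI p S mach jstar i)))
  where

  open Admissible adm

  Uₕ Vₕ Aₕ Jₕ Jₕ′ Jₕ″ Uᵢ Vᵢ Jᵢ Gᵢ Jᵢ′ Jᵢ″ : List (Fin n)
  Uₕ = upTo S mach h jstar
  Vₕ = after S mach h jstar
  Aₕ = take (length Uₕ ∸ 2 * pmax p) Uₕ
  Jₕ = JH p S mach jstar h
  Jₕ′ = filterᵇ H' Jₕ
  Jₕ″ = filterᵇ (not ∘ H') Jₕ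
  Uᵢ = upTo S mach i jstar
  Vᵢ = after S mach i jstar
  Jᵢ = JI p S mach jstar i
  Gᵢ = drop (2 * pmax p) Vᵢ
  Jᵢ′ = filterᵇ I' Jᵢ
  Jᵢ″ = filterᵇ (not ∘ I') Jᵢ

  Uₕ-split : Aₕ ++ Jₕ ≡ Uₕ
  Uₕ-split = take++drop≡id (length Uₕ ∸ 2 * pmax p) Uₕ

  Vᵢ-split : Jᵢ ++ Gᵢ ≡ Vᵢ
  Vᵢ-split = take++drop≡id (2 * pmax p) Vᵢ

  σ-onTime : ∀ k → OnTime p d 0 (upTo S mach k jstar ++ after S mach k jstar)
  σ-onTime k = subst (OnTime p d 0) (sym (upTo-++-after S mach k jstar))
                     (machineJobs-onTime S mach p d σ-due k)

  σₕ-onTime : OnTime p d 0 (Aₕ ++ Jₕ ++ Vₕ)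
  σₕ-onTime = subst (OnTime p d 0)
    (trans (cong (_++ Vₕ) (sym Uₕ-split)) (++-assoc Aₕ Jₕ Vₕ)) (σ-onTime h)

  σᵢ-onTime : OnTime p d 0 (Uᵢ ++ Jᵢ ++ Gᵢ)
  σᵢ-onTime = subst (λ zs → OnTime p d 0 (Uᵢ ++ zs)) (sym Vᵢ-split) (σ-onTime i)

  Jₕ-onTime : OnTime p d (P p Aₕ) Jₕ
  Jₕ-onTime = onTime-++⁻ˡ p d Jₕ (onTime-++⁻ʳ p d Aₕ σₕ-onTime)

  P-Uₕ : P p Uₕ ≡ P p Aₕ + P p Jₕ
  P-Uₕ = trans (cong (P p) (sym Uₕ-split)) (P-++ p Aₕ Jₕ)

  Jᵢ-due-after-Uₕ : All (λ j → + P p Uₕ ℤ.≤ d j) Jᵢ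
  Jᵢ-due-after-Uₕ =
    All.map (λ jstar<j → ℤP.≤-trans jstar-due (d-mono jstar _ (<⇒≤ (<ᵇ⇒< _ _ jstar<j))))
            (take⁺ (2 * pmax p) (all-filter _ (machineJobs S mach i)))
    where
    jstar-due : + P p Uₕ ℤ.≤ d jstar
    jstar-due = subst (λ k → + P p (upTo S mach k jstar) ℤ.≤ d jstar) jstar∈Mh
                      (σ-due jstar jstar∈S)

  blockBound : ℕ
  blockBound = 2 * pmax p * pmax p

  Jₕ-short : P p Jₕ ≤ blockBound
  Jₕ-short = P≤*pmax p Jₕ (begin
    length Jₕ                ≡⟨ length-drop prefixLength Uₕ ⟩
    length Uₕ ∸ prefixLength ≤⟨ m≤n+o⇒m∸n≤o (length Uₕ) prefixLength length-Uₕ≤ ⟩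
    2 * pmax p               ∎)
    where
    open ≤-Reasoning
    prefixLength : ℕ
    prefixLength = length Uₕ ∸ 2 * pmax p
    length-Uₕ≤ : length Uₕ ≤ prefixLength + 2 * pmax p
    length-Uₕ≤ = ≤-trans (m≤n+m∸n (length Uₕ) (2 * pmax p))
                         (≤-reflexive (+-comm (2 * pmax p) prefixLength))

  Jᵢ-short : P p Jᵢ ≤ blockBound
  Jᵢ-short = P≤*pmax p Jᵢ
    (≤-trans (≤-reflexive (length-take (2 * pmax p) Vᵢ)) (m⊓n≤m _ _))

  gap : P p Uᵢ + (blockBound + blockBound) ≤ P p Aₕ + P p Jₕ
  gap = subst₂ (λ a b → P p Uᵢ + a ≤ b) (four-squares (pmax p)) P-Uₕ condIII
    where
    four-squares : ∀ q → 4 * q ^ 2 ≡ 2 * q * q + 2 * q * q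
    four-squares = solve 1 (λ q → con 4 :* (q :^ 2) := con 2 :* q :* q :+ con 2 :* q :* q) refl
      where open +-*-Solver

  Jₕ′-fits-before-Jₕ : P p Uᵢ + P p Jₕ′ ≤ P p Aₕ
  Jₕ′-fits-before-Jₕ = +-cancelʳ-≤ (P p Jₕ) _ _ (begin
    P p Uᵢ + P p Jₕ′ + P p Jₕ          ≡⟨ +-assoc (P p Uᵢ) _ _ ⟩
    P p Uᵢ + (P p Jₕ′ + P p Jₕ)        ≤⟨ +-monoʳ-≤ (P p Uᵢ) (+-mono-≤ Jₕ′-short Jₕ-short) ⟩
    P p Uᵢ + (blockBound + blockBound) ≤⟨ gap ⟩
    P p Aₕ + P p Jₕ                    ∎)
    where
    open ≤-Reasoning
    Jₕ′-short : P p Jₕ′ ≤ blockBound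
    Jₕ′-short = ≤-trans (P-filter-≤ p H' Jₕ) Jₕ-short

  Jᵢ-fits-in-Uₕ : P p Uᵢ + P p Jᵢ ≤ P p Uₕ
  Jᵢ-fits-in-Uₕ = begin
    P p Uᵢ + P p Jᵢ                    ≤⟨ +-monoʳ-≤ (P p Uᵢ) (≤-trans Jᵢ-short (m≤m+n _ _)) ⟩
    P p Uᵢ + (blockBound + blockBound) ≤⟨ gap ⟩
    P p Aₕ + P p Jₕ                    ≡⟨ P-Uₕ ⟨
    P p Uₕ                             ∎
    where open ≤-Reasoning

  σ′ₕ-onTime : OnTime p d 0 (Aₕ ++ Jₕ″ ++ Jᵢ′ ++ Vₕ)
  σ′ₕ-onTime = onTime-exchange p d Aₕ Jₕ″ Jᵢ′ σₕ-onTime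
    (onTime-++⁺ p d (onTime-filter⁺ p d (not ∘ H') Jₕ-onTime)
      (onTime-by p d (P p Uₕ) (≤-reflexive Jᵢ′-ends-at-Uₕ)
        (All-filter⁺ _ Jᵢ-due-after-Uₕ)))
    same-duration
    where
    same-duration : P p Jₕ″ + P p Jᵢ′ ≡ P p Jₕ
    same-duration = begin
      P p Jₕ″ + P p Jᵢ′ ≡⟨ cong (_+_ (P p Jₕ″)) balanced ⟨
      P p Jₕ″ + P p Jₕ′ ≡⟨ +-comm (P p Jₕ″) (P p Jₕ′) ⟩
      P p Jₕ′ + P p Jₕ″ ≡⟨ P-filter-+-P-filter-not p H' Jₕ ⟩
      P p Jₕ            ∎
      where open ≡-Reasoning
    Jᵢ′-ends-at-Uₕ : P p Aₕ + P p Jₕ″ + P p Jᵢ′ ≡ P p Uₕ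
    Jᵢ′-ends-at-Uₕ = trans (+-assoc (P p Aₕ) _ _)
                           (trans (cong (_+_ (P p Aₕ)) same-duration) (sym P-Uₕ))

  σ′ᵢ-onTime : OnTime p d 0 (Uᵢ ++ Jₕ′ ++ Jᵢ″ ++ Gᵢ)
  σ′ᵢ-onTime = onTime-exchange p d Uᵢ Jₕ′ Jᵢ″ σᵢ-onTime
    (onTime-++⁺ p d
      (onTime-by p d (P p Aₕ) Jₕ′-fits-before-Jₕ
        (All-filter⁺ _ (onTime⇒start≤due p d Jₕ-onTime)))
      (onTime-by p d (P p Uₕ) Jᵢ″-ends-by-Uₕ (All-filter⁺ _ Jᵢ-due-after-Uₕ)))
    same-duration
    where
    same-duration : P p Jₕ′ + P p Jᵢ″ ≡ P p Jᵢ
    same-duration = trans (cong (_+ P p Jᵢ″) balanced) (P-filter-+-P-filter-not p I' Jᵢ)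
    Jᵢ″-ends-by-Uₕ : P p Uᵢ + P p Jₕ′ + P p Jᵢ″ ≤ P p Uₕ
    Jᵢ″-ends-by-Uₕ = ≤-trans
      (≤-reflexive (trans (+-assoc (P p Uᵢ) _ _) (cong (_+_ (P p Uᵢ)) same-duration)))
      Jᵢ-fits-in-Uₕ

  σ′-onTime : ∀ k → OnTime p d 0 (intermediate p S mach jstar h i H' I' k)
  σ′-onTime k with k ≟ᶠ h | k ≟ᶠ i
  ... | yes _ | _     = σ′ₕ-onTime
  ... | no _  | yes _ = σ′ᵢ-onTime
  ... | no _  | no _  = machineJobs-onTime S mach p d σ-due k

lemma8 : (n m : ℕ) (p w : Fin n → ℕ) (d : Fin n → ℤ) →
    (∀ j → 1 ≤ p j) →
    (∀ j k → toℕ j ≤ toℕ k → d j ℤ.≤ d k) →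
    (S : Fin n → Bool) (mach : Fin n → Fin m) →
    (∀ j → S j ≡ true → + (completion p S mach j) ℤ.≤ d j) →
    (jstar : Fin n) (h i : Fin m) →
    Admissible p S mach jstar h i →
    (H' I' : Fin n → Bool) →
    filterᵇ H' (JH p S mach jstar h) ≢ [] →
    filterᵇ I' (JI p S mach jstar i) ≢ [] →
    P p (filterᵇ H' (JH p S mach jstar h)) ≡ P p (filterᵇ I' (JI p S mach jstar i)) →
    sumWU p w d S (intermediate p S mach jstar h i H' I')
      ≤ sumWU p w d S (properSchedule S mach)
lemma8 n m p w d _ d-mono S mach σ-due jstar h i adm H' I' _ _ balanced =
  onTime⇒sumWU-minimal p w d S (intermediate p S mach jstar h i H' I') (properSchedule S mach)
    (Swap.σ′-onTime p d d-mono S mach σ-due adm H' I' balanced)
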